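{- Let $r\ge 3$ be an integer and let $k$ be a positive integer that is a multiple of $r-1$. Then $$\chi_l(K_{2r,r*(k-1)}^r)>\chi(K_{2r,r*(k-1)}^r)=k.$$
   Context: All hypergraphs are finite. An $r$-uniform hypergraph has all edges of size $r$. A vertex coloring of a hypergraph is proper if no edge is monochromatic (every edge contains two vertices of different colors). $\chi(H)$ is the chromatic number. A $k$-list assignment $L$ assigns to each vertex $v$ a set $L(v)$ of exactly $k$ colors; an $L$-coloring is a proper coloring with each vertex $v$ colored from $L(v)$; $H$ is $k$-choosable if it is $L$-colorable for every $k$-list assignment $L$, and $\chi_l(H)$ is the least such $k$. For positive integers $p_1,\dots,p_k$ and disjoint sets $V_1,\dots,V_k$ with $|V_i|=p_i$, the $r$-complete $k$-partite hypergraph $K^r_{p_1,\dots,p_k}$ has vertex set $V_1\cup\cdots\cup V_k$ and edge set consisting of all $r$-subsets $S$ of the vertex set with $S\not\subseteq V_i$ for every $i$. The notation $K^r_{p*s,p_{s+1},\dots}$ means that $s$ parts have size $p$; thus $K_{2r,r*(k-1)}^r$ has one part of size $2r$ and $k-1$ parts of size $r$. -}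

module Defs where

open import Data.Nat using (ℕ; zero; suc; _*_; _<_; _≤_)
open import Data.Fin using (Fin; toℕ; _≟_)
open import Data.Fin.Subset using (Subset; _∈_; ∣_∣)
open import Data.Vec using (tabulate)
open import Data.Product using (Σ; ∃; ∃-syntax; _×_; _,_)
open import Relation.Nullary using (¬_; does)
open import Relation.Binary.PropositionalEquality using (_≡_; _≢_)
open import Function.Definitions using (Injective)

record Hypergraph (n : ℕ) : Set₁ where
  field
    Edge : Subset n → Set
open Hypergraph public

Uniform : {n : ℕ} → ℕ → Hypergraph n → Set
Uniform r H = ∀ S → Edge H S → ∣ S ∣ ≡ r

Proper : {n : ℕ} {C : Set} → Hypergraph n → (Fin n → C) → Set
Proper H c = ∀ S → Edge H S → ∃[ u ] ∃[ v ] (u ∈ S × v ∈ S × c u ≢ c v)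

Colorable : {n : ℕ} → Hypergraph n → ℕ → Set
Colorable H m = Σ (Fin _ → Fin m) λ c → Proper H c

ChromaticNumberIs : {n : ℕ} → Hypergraph n → ℕ → Set
ChromaticNumberIs H k = Colorable H k × (∀ m → m < k → ¬ Colorable H m)

ListAssignment : ℕ → ℕ → Set
ListAssignment n k = Σ (Fin n → Fin k → ℕ) λ L → ∀ v → Injective _≡_ _≡_ (L v)

LColorable : {n k : ℕ} → Hypergraph n → ListAssignment n k → Set
LColorable {n} {k} H (L , _) =
  Σ (Fin n → ℕ) λ c → (∀ v → ∃[ i ] (c v ≡ L v i)) × Proper H c

Choosable : {n : ℕ} → Hypergraph n → ℕ → Set
Choosable {n} H k = (L : ListAssignment n k) → LColorable H L

ChoiceNumberGreaterThan : {n : ℕ} → Hypergraph n → ℕ → Set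
ChoiceNumberGreaterThan H k = ∀ m → m ≤ k → ¬ Choosable H m

PartSet : {n k : ℕ} → (Fin n → Fin k) → Fin k → Subset n
PartSet part i = tabulate λ v → does (part v ≟ i)

CompleteMultipartite : {n k : ℕ} → ℕ → (Fin n → Fin k) → Hypergraph n
CompleteMultipartite {n} {k} r part = record
  { Edge = λ S → (∣ S ∣ ≡ r) × (∀ i → ¬ (∀ v → v ∈ S → part v ≡ i)) }

-- part sizes for K^r_{2r, r*(k-1)}: first part has 2r vertices, the others r.
sizes : ℕ → {k : ℕ} → Fin k → ℕ
sizes r i with toℕ i
... | zero = 2 * r
... | suc _ = r

HasPartSizes : {n k : ℕ} → (Fin n → Fin k) → (Fin k → ℕ) → Set
HasPartSizes part p = ∀ i → ∣ PartSet part i ∣ ≡ p i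

-- Charge every pair (part i, colour x) with r − 1 if colour x occurs only in part i, and with the
-- number of vertices of part i coloured x otherwise. In a proper colouring a colour class meeting
-- two parts has at most r − 1 vertices (r of them, two in different parts, would form a
-- monochromatic edge), so each colour carries total charge at most r − 1, while each part of size
-- at least r − 1 carries charge at least r − 1; hence at least k colours are needed, and colouring
-- by parts shows that k suffice.
--
-- For the list bound write k = t(r − 1) and cut the palette {0, …, k + t − 1} into r blocks of t
-- consecutive colours; the vertex of rank j in its part gets the k colours outside block j mod r.
-- Every colour is then missed by a vertex of each part and by two vertices of the part of size 2r,
-- which raises the charge of each part of size r to r and of the large part to r + 1: in total
-- kr + 1, more than the (k + t)(r − 1) = kr that k + t colours can carry.
module Submission where

open import Defs
open import Data.Bool using (if_then_else_)
open import Data.Empty using (⊥)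
open import Data.Fin using (Fin; zero; suc; toℕ; _≟_; fromℕ<)
open import Data.Fin.Properties using (any?; all?; toℕ-injective; toℕ<n; toℕ-fromℕ<)
open import Data.Fin.Subset using (Subset; inside; outside; _∈_; _⊆_; _∪_; ⁅_⁆; ∣_∣)
open import Data.Fin.Subset.Properties
  using (_∈?_; p⊆p∪q; q⊆p∪q; x∈p∪q⁻; x∈⁅x⁆; x∈⁅y⁆⇒x≡y; ∣⁅x⁆∣≡1; out⊆; s⊆s; in⊆in; ⊆-refl; drop-∷-⊆)
open import Data.Nat
  using (ℕ; zero; suc; _+_; _*_; _∸_; _≤_; _<_; _<?_; z≤n; s≤s; s≤s⁻¹; NonZero; >-nonZero⁻¹)
open import Data.Nat.Divisibility using (_∣_; divides)
open import Data.Nat.DivMod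
  using (_/_; _%_; m/n*n≤m; m≡m%n+[m/n]*n; m%n<n; m<n*o⇒m/o<n; m<n⇒m%n≡m; [m+n]%n≡m%n)
open import Data.Nat.Properties hiding (_≟_)
open import Data.Product using (_×_; ∃-syntax; Σ-syntax; _,_; proj₁; proj₂; swap)
open import Data.Sum using (inj₁; inj₂)
open import Data.Vec using (_∷_; []; tabulate; here)
open import Data.Vec.Functional using (updateAt)
open import Data.Vec.Functional.Properties using (updateAt-updates; updateAt-minimal)
open import Data.Vec.Properties using (lookup∘tabulate; []=⇒lookup; lookup⇒[]=)
open import Function using (_∘_)
open import Function.Definitions using (Injective)
open import Level using (0ℓ)
open import Relation.Binary.PropositionalEquality
open import Relation.Nullary using (Dec; yes; no; does; ¬_; contradiction)
open import Relation.Nullary.Decidable using (dec-true; _×-dec_; _→-dec_; ¬?; decidable-stable)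
open import Relation.Unary using (Pred; Decidable)

open import Algebra.Properties.CommutativeMonoid.Sum +-0-commutativeMonoid
  using (sum; sum-syntax; ∑-comm; sum-cong-≗; sum-replicate-zero)

⟦_⟧ : ∀ {a} {A : Set a} → Dec A → ℕ
⟦ a? ⟧ = if does a? then 1 else 0

⟦⟧≡1 : ∀ {A : Set} (a? : Dec A) → A → ⟦ a? ⟧ ≡ 1
⟦⟧≡1 (yes _) _ = refl
⟦⟧≡1 (no ¬a) a = contradiction a ¬a

⟦⟧≡0 : ∀ {A : Set} (a? : Dec A) → ¬ A → ⟦ a? ⟧ ≡ 0
⟦⟧≡0 (yes a) ¬a = contradiction a ¬a
⟦⟧≡0 (no _) _ = refl

⟦⟧-mono : ∀ {A B : Set} → (A → B) → (a? : Dec A) (b? : Dec B) → ⟦ a? ⟧ ≤ ⟦ b? ⟧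
⟦⟧-mono f (yes a) b? = ≤-reflexive (sym (⟦⟧≡1 b? (f a)))
⟦⟧-mono f (no _) b? = z≤n

sum-mono : ∀ {n} {f g : Fin n → ℕ} → (∀ i → f i ≤ g i) → sum f ≤ sum g
sum-mono {zero} f≤g = z≤n
sum-mono {suc n} f≤g = +-mono-≤ (f≤g zero) (sum-mono (f≤g ∘ suc))

sum-const : ∀ n a → ∑[ i < n ] a ≡ n * a
sum-const zero a = refl
sum-const (suc n) a = cong (a +_) (sum-const n a)

sum-zero : ∀ {n} {f : Fin n → ℕ} → (∀ i → f i ≡ 0) → sum f ≡ 0
sum-zero {n} f≡0 = trans (sum-cong-≗ f≡0) (sum-replicate-zero n)

erase : ∀ {n} → Fin n → (Fin n → ℕ) → Fin n → ℕ
erase a f = updateAt f a λ _ → 0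

erase-≢ : ∀ {n} (f : Fin n → ℕ) {a b} → a ≢ b → erase a f b ≡ f b
erase-≢ f {a} {b} a≢b = updateAt-minimal b a f (a≢b ∘ sym)

sum-erase : ∀ {n} (f : Fin n → ℕ) a → sum f ≡ f a + sum (erase a f)
sum-erase f zero = refl
sum-erase f (suc a) = begin
  f zero + sum (f ∘ suc)         ≡⟨ cong (f zero +_) (sum-erase (f ∘ suc) a) ⟩
  f zero + (f (suc a) + rest)    ≡⟨ +-assoc (f zero) (f (suc a)) rest ⟨
  f zero + f (suc a) + rest      ≡⟨ cong (_+ rest) (+-comm (f zero) (f (suc a))) ⟩
  f (suc a) + f zero + rest      ≡⟨ +-assoc (f (suc a)) (f zero) rest ⟩
  f (suc a) + (f zero + rest)    ∎
  where
  open ≡-Reasoning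
  rest : ℕ
  rest = sum (erase a (f ∘ suc))

term≤sum : ∀ {n} (f : Fin n → ℕ) a → f a ≤ sum f
term≤sum f a = begin
  f a                    ≤⟨ m≤m+n (f a) _ ⟩
  f a + sum (erase a f)  ≡⟨ sum-erase f a ⟨
  sum f                  ∎
  where open ≤-Reasoning

pair≤sum : ∀ {n} (f : Fin n → ℕ) {a b} → a ≢ b → f a + f b ≤ sum f
pair≤sum f {a} {b} a≢b = begin
  f a + f b              ≡⟨ cong (f a +_) (erase-≢ f a≢b) ⟨
  f a + erase a f b      ≤⟨ +-monoʳ-≤ (f a) (term≤sum (erase a f) b) ⟩
  f a + sum (erase a f)  ≡⟨ sum-erase f a ⟨
  sum f                  ∎
  where open ≤-Reasoning

triple≤sum : ∀ {n} (f : Fin n → ℕ) {a b e} → a ≢ b → a ≢ e → b ≢ e →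
             f a + f b + f e ≤ sum f
triple≤sum f {a} {b} {e} a≢b a≢e b≢e = begin
  f a + f b + f e                    ≡⟨ +-assoc (f a) (f b) (f e) ⟩
  f a + (f b + f e)                  ≡⟨ cong₂ (λ u v → f a + (u + v))
                                              (erase-≢ f a≢b) (erase-≢ f a≢e) ⟨
  f a + (erase a f b + erase a f e)  ≤⟨ +-monoʳ-≤ (f a) (pair≤sum (erase a f) b≢e) ⟩
  f a + sum (erase a f)              ≡⟨ sum-erase f a ⟨
  sum f                              ∎
  where open ≤-Reasoning

sum-supported : ∀ {n} (f : Fin n → ℕ) a → (∀ i → i ≢ a → f i ≡ 0) → sum f ≡ f a
sum-supported f a vanish = begin
  sum f                  ≡⟨ sum-erase f a ⟩
  f a + sum (erase a f)  ≡⟨ cong (f a +_) (sum-zero erased) ⟩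
  f a + 0                ≡⟨ +-identityʳ (f a) ⟩
  f a                    ∎
  where
  open ≡-Reasoning
  erased : ∀ i → erase a f i ≡ 0
  erased i with i ≟ a
  ... | yes refl = updateAt-updates a f
  ... | no i≢a = trans (erase-≢ f (i≢a ∘ sym)) (vanish i i≢a)

count : ∀ {n} {P : Pred (Fin n) 0ℓ} → Decidable P → ℕ
count {n} P? = ∑[ w < n ] ⟦ P? w ⟧

count-mono : ∀ {n} {P Q : Pred (Fin n) 0ℓ} (P? : Decidable P) (Q? : Decidable Q) →
             (∀ w → P w → Q w) → count P? ≤ count Q?
count-mono P? Q? P⇒Q = sum-mono λ w → ⟦⟧-mono (P⇒Q w) (P? w) (Q? w)

count-cong : ∀ {n} {P Q : Pred (Fin n) 0ℓ} (P? : Decidable P) (Q? : Decidable Q) →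
             (∀ w → P w → Q w) → (∀ w → Q w → P w) → count P? ≡ count Q?
count-cong P? Q? P⇒Q Q⇒P = ≤-antisym (count-mono P? Q? P⇒Q) (count-mono Q? P? Q⇒P)

module _ {n : ℕ} {P : Pred (Fin n) 0ℓ} (P? : Decidable P) where

  count-empty : (∀ w → ¬ P w) → count P? ≡ 0
  count-empty ¬P = sum-zero λ w → ⟦⟧≡0 (P? w) (¬P w)

  count-≥1 : ∀ {w} → P w → 1 ≤ count P?
  count-≥1 {w} Pw = subst (_≤ count P?) (⟦⟧≡1 (P? w) Pw) (term≤sum _ w)

  count-≥2 : ∀ {w w′} → w ≢ w′ → P w → P w′ → 2 ≤ count P?
  count-≥2 {w} {w′} w≢w′ Pw Pw′ = subst₂ (λ a b → a + b ≤ count P?)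
    (⟦⟧≡1 (P? w) Pw) (⟦⟧≡1 (P? w′) Pw′) (pair≤sum _ w≢w′)

∑-⟦≟⟧ : ∀ {k} (a : Fin k) → ∑[ i < k ] ⟦ a ≟ i ⟧ ≡ 1
∑-⟦≟⟧ {suc k} zero = cong suc (sum-zero {k} λ _ → refl)
∑-⟦≟⟧ (suc a) = ∑-⟦≟⟧ a

∑-count-fibres : ∀ {n k} {P : Pred (Fin n) 0ℓ} (P? : Decidable P) (f : Fin n → Fin k) →
                 ∑[ i < k ] count (λ w → P? w ×-dec f w ≟ i) ≡ count P?
∑-count-fibres {n} {k} P? f = begin
  ∑[ i < k ] ∑[ w < n ] ⟦ P? w ×-dec f w ≟ i ⟧  ≡⟨ ∑-comm (λ i w → ⟦ P? w ×-dec f w ≟ i ⟧) ⟩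
  ∑[ w < n ] ∑[ i < k ] ⟦ P? w ×-dec f w ≟ i ⟧  ≡⟨ sum-cong-≗ (λ w → fibre (P? w) (f w)) ⟩
  count P?                                      ∎
  where
  open ≡-Reasoning
  fibre : ∀ {A : Set} (a? : Dec A) a → ∑[ i < k ] ⟦ a? ×-dec a ≟ i ⟧ ≡ ⟦ a? ⟧
  fibre (yes _) a = ∑-⟦≟⟧ a
  fibre (no _) a = sum-zero {k} λ _ → refl

rank : ∀ {n} {P : Pred (Fin n) 0ℓ} → Decidable P → Fin n → ℕ
rank P? zero = 0
rank P? (suc w) = ⟦ P? zero ⟧ + rank (P? ∘ suc) w

rank-surjective : ∀ {n} {P : Pred (Fin n) 0ℓ} (P? : Decidable P) {j} →
                  j < count P? → ∃[ w ] (P w × rank P? w ≡ j)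
rank-surjective {suc n} P? {j} j<count with P? zero | j
... | yes P0 | zero = zero , P0 , refl
... | yes P0 | suc j with rank-surjective (P? ∘ suc) (s≤s⁻¹ j<count)
...   | w , Pw , rank≡j = suc w , Pw , cong₂ _+_ (⟦⟧≡1 (P? zero) P0) rank≡j
rank-surjective {suc n} P? {j} j<count | no ¬P0 | _ with rank-surjective (P? ∘ suc) j<count
... | w , Pw , rank≡j = suc w , Pw , cong₂ _+_ (⟦⟧≡0 (P? zero) ¬P0) rank≡j

∣p∪q∣≤∣p∣+∣q∣ : ∀ {n} (p q : Subset n) → ∣ p ∪ q ∣ ≤ ∣ p ∣ + ∣ q ∣
∣p∪q∣≤∣p∣+∣q∣ [] [] = z≤n
∣p∪q∣≤∣p∣+∣q∣ (outside ∷ p) (outside ∷ q) = ∣p∪q∣≤∣p∣+∣q∣ p q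
∣p∪q∣≤∣p∣+∣q∣ (outside ∷ p) (inside ∷ q) =
  subst (suc ∣ p ∪ q ∣ ≤_) (sym (+-suc ∣ p ∣ ∣ q ∣)) (s≤s (∣p∪q∣≤∣p∣+∣q∣ p q))
∣p∪q∣≤∣p∣+∣q∣ (inside ∷ p) (outside ∷ q) = s≤s (∣p∪q∣≤∣p∣+∣q∣ p q)
∣p∪q∣≤∣p∣+∣q∣ (inside ∷ p) (inside ∷ q) =
  s≤s (≤-trans (∣p∪q∣≤∣p∣+∣q∣ p q) (+-monoʳ-≤ ∣ p ∣ (n≤1+n ∣ q ∣)))

subset-between : ∀ {n m} {T C : Subset n} → T ⊆ C → ∣ T ∣ ≤ m → m ≤ ∣ C ∣ →
                 ∃[ S ] (T ⊆ S × S ⊆ C × ∣ S ∣ ≡ m)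
subset-between {T = []} {[]} _ _ z≤n = [] , (λ ()) , (λ ()) , refl
subset-between {m = suc m} {inside ∷ T} {inside ∷ C} T⊆C ∣T∣≤m m≤∣C∣
  with subset-between (drop-∷-⊆ T⊆C) (s≤s⁻¹ ∣T∣≤m) (s≤s⁻¹ m≤∣C∣)
... | S , T⊆S , S⊆C , ∣S∣≡m = inside ∷ S , in⊆in T⊆S , in⊆in S⊆C , cong suc ∣S∣≡m
subset-between {T = inside ∷ T} {outside ∷ C} T⊆C _ _ with T⊆C here
... | ()
subset-between {T = outside ∷ T} {outside ∷ C} T⊆C ∣T∣≤m m≤∣C∣
  with subset-between (drop-∷-⊆ T⊆C) ∣T∣≤m m≤∣C∣
... | S , T⊆S , S⊆C , ∣S∣≡m = outside ∷ S , s⊆s T⊆S , s⊆s S⊆C , ∣S∣≡m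
subset-between {m = m} {outside ∷ T} {inside ∷ C} T⊆C ∣T∣≤m m≤1+∣C∣
  with m≤n⇒m<n∨m≡n m≤1+∣C∣
... | inj₂ refl = inside ∷ C , out⊆ (drop-∷-⊆ T⊆C) , ⊆-refl , refl
... | inj₁ m<1+∣C∣ with subset-between (drop-∷-⊆ T⊆C) ∣T∣≤m (s≤s⁻¹ m<1+∣C∣)
...   | S , T⊆S , S⊆C , ∣S∣≡m = outside ∷ S , s⊆s T⊆S , out⊆ S⊆C , ∣S∣≡m

∣tabulate∣≡count : ∀ {n} {P : Pred (Fin n) 0ℓ} (P? : Decidable P) →
                   ∣ tabulate (does ∘ P?) ∣ ≡ count P?
∣tabulate∣≡count {zero} P? = refl
∣tabulate∣≡count {suc n} P? with P? zero
... | yes _ = cong suc (∣tabulate∣≡count (P? ∘ suc))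
... | no _ = ∣tabulate∣≡count (P? ∘ suc)

module _ {n : ℕ} {P : Pred (Fin n) 0ℓ} (P? : Decidable P) where

  ∈-tabulate⁻ : ∀ {w} → w ∈ tabulate (does ∘ P?) → P w
  ∈-tabulate⁻ {w} w∈ with P? w | trans (sym (lookup∘tabulate (does ∘ P?) w)) ([]=⇒lookup w∈)
  ... | yes Pw | _ = Pw
  ... | no _ | ()

  ∈-tabulate⁺ : ∀ {w} → P w → w ∈ tabulate (does ∘ P?)
  ∈-tabulate⁺ {w} Pw =
    lookup⇒[]= w _ (trans (lookup∘tabulate (does ∘ P?) w) (dec-true (P? w) Pw))

proper-reflect : ∀ {n} {C D : Set} {H : Hypergraph n} {c : Fin n → D} {c′ : Fin n → C}
                 (g : C → D) → (∀ v → g (c′ v) ≡ c v) → Proper H c → Proper H c′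
proper-reflect g g∘c′≡c proper S edge with proper S edge
... | u , v , u∈S , v∈S , cu≢cv = u , v , u∈S , v∈S , λ c′u≡c′v →
  cu≢cv (trans (sym (g∘c′≡c u)) (trans (cong g c′u≡c′v) (g∘c′≡c v)))

choosable⇒colourable : ∀ {n m} {H : Hypergraph n} → Choosable H m → Colorable H m
choosable⇒colourable choose with choose ((λ _ → toℕ) , λ _ → toℕ-injective)
... | c , c∈L , proper =
  (λ v → proj₁ (c∈L v)) , proper-reflect toℕ (λ v → sym (proj₂ (c∈L v))) proper

∃-outside-part : ∀ {n k} (part : Fin n → Fin k) (S : Subset n) i →
                 ¬ (∀ v → v ∈ S → part v ≡ i) → ∃[ v ] (v ∈ S × part v ≢ i)
∃-outside-part part S i not-within with any? (λ v → v ∈? S ×-dec ¬? (part v ≟ i))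
... | yes witness = witness
... | no none = contradiction within not-within
  where
  within : ∀ v → v ∈ S → part v ≡ i
  within v v∈S = decidable-stable (part v ≟ i) λ pv≢i → none (v , v∈S , pv≢i)

part-proper : ∀ {n k} r (part : Fin n → Fin (suc k)) →
              Proper (CompleteMultipartite r part) part
part-proper r part S (_ , spans) with ∃-outside-part part S zero (spans zero)
... | u , u∈S , _ with ∃-outside-part part S (part u) (spans (part u))
... | v , v∈S , pv≢pu = u , v , u∈S , v∈S , pv≢pu ∘ sym

module _ {n k p : ℕ} (d : ℕ) .{{_ : NonZero d}} (part : Fin n → Fin k) {c : Fin n → Fin p}
         (proper : Proper (CompleteMultipartite (suc d) part) c) where

  spanning-colourClass≤ : ∀ {u v x} → c u ≡ x → c v ≡ x → part u ≢ part v →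
                          count (λ w → c w ≟ x) ≤ d
  spanning-colourClass≤ {u} {v} {x} cu≡x cv≡x pu≢pv = ≮⇒≥ λ d<∣C∣ →
    monochromatic (subset-between T⊆C ∣T∣≤1+d (subst (d <_) (sym (∣tabulate∣≡count colour?)) d<∣C∣))
    where
    colour? : Decidable (λ w → c w ≡ x)
    colour? w = c w ≟ x
    C T : Subset n
    C = tabulate (does ∘ colour?)
    T = ⁅ u ⁆ ∪ ⁅ v ⁆
    u∈T : u ∈ T
    u∈T = p⊆p∪q ⁅ v ⁆ (x∈⁅x⁆ u)
    v∈T : v ∈ T
    v∈T = q⊆p∪q ⁅ u ⁆ ⁅ v ⁆ (x∈⁅x⁆ v)
    T⊆C : T ⊆ C
    T⊆C {w} w∈T with x∈p∪q⁻ ⁅ u ⁆ ⁅ v ⁆ w∈T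
    ... | inj₁ w∈⁅u⁆ rewrite x∈⁅y⁆⇒x≡y u w∈⁅u⁆ = ∈-tabulate⁺ colour? cu≡x
    ... | inj₂ w∈⁅v⁆ rewrite x∈⁅y⁆⇒x≡y v w∈⁅v⁆ = ∈-tabulate⁺ colour? cv≡x
    ∣T∣≤1+d : ∣ T ∣ ≤ suc d
    ∣T∣≤1+d = begin
      ∣ T ∣                  ≤⟨ ∣p∪q∣≤∣p∣+∣q∣ ⁅ u ⁆ ⁅ v ⁆ ⟩
      ∣ ⁅ u ⁆ ∣ + ∣ ⁅ v ⁆ ∣  ≡⟨ cong₂ _+_ (∣⁅x⁆∣≡1 u) (∣⁅x⁆∣≡1 v) ⟩
      2                      ≤⟨ s≤s (>-nonZero⁻¹ d) ⟩
      suc d                  ∎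
      where open ≤-Reasoning
    spans : ∀ {S} → T ⊆ S → ∀ i → ¬ (∀ w → w ∈ S → part w ≡ i)
    spans T⊆S i within = pu≢pv (trans (within u (T⊆S u∈T)) (sym (within v (T⊆S v∈T))))
    monochromatic : ∃[ S ] (T ⊆ S × S ⊆ C × ∣ S ∣ ≡ suc d) → ⊥
    monochromatic (S , T⊆S , S⊆C , ∣S∣≡r) with proper S (∣S∣≡r , spans T⊆S)
    ... | w , w′ , w∈S , w′∈S , cw≢cw′ =
      cw≢cw′ (trans (∈-tabulate⁻ colour? (S⊆C w∈S)) (sym (∈-tabulate⁻ colour? (S⊆C w′∈S))))

module Charging {n k p : ℕ} (d : ℕ) (part : Fin n → Fin k) (c : Fin n → Fin p) where

  cellCount : Fin k → Fin p → ℕ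
  cellCount i x = count (λ w → part w ≟ i ×-dec c w ≟ x)

  Pure : Fin k → Fin p → Set
  Pure i x = (∃[ w ] c w ≡ x) × (∀ w → c w ≡ x → part w ≡ i)

  pure? : ∀ i x → Dec (Pure i x)
  pure? i x = any? (λ w → c w ≟ x) ×-dec all? (λ w → c w ≟ x →-dec part w ≟ i)

  charge : Fin k → Fin p → ℕ
  charge i x with pure? i x
  ... | yes _ = d
  ... | no _ = cellCount i x

  pure-unique : ∀ {i j x} → Pure i x → Pure j x → i ≡ j
  pure-unique ((w , cw≡x) , in-i) (_ , in-j) = trans (sym (in-i w cw≡x)) (in-j w cw≡x)

  charge-pure : ∀ {i x} → Pure i x → charge i x ≡ d
  charge-pure {i} {x} pure with pure? i x
  ... | yes _ = refl
  ... | no impure = contradiction pure impure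

  charge-impure : ∀ {i x} → ¬ Pure i x → charge i x ≡ cellCount i x
  charge-impure {i} {x} impure with pure? i x
  ... | yes pure = contradiction pure impure
  ... | no _ = refl

  charge≥ : ∀ {m i x} → m ≤ d → m ≤ cellCount i x → m ≤ charge i x
  charge≥ {i = i} {x} m≤d m≤cell with pure? i x
  ... | yes _ = m≤d
  ... | no _ = m≤cell

  charge-elsewhere : ∀ {i j x} → Pure i x → j ≢ i → charge j x ≡ 0
  charge-elsewhere {i} {j} {x} pure j≢i = begin
    charge j x     ≡⟨ charge-impure (λ pure-j → j≢i (pure-unique pure-j pure)) ⟩
    cellCount j x  ≡⟨ count-empty (λ w → part w ≟ j ×-dec c w ≟ x) outside-j ⟩
    0              ∎
    where
    open ≡-Reasoning
    outside-j : ∀ w → ¬ (part w ≡ j × c w ≡ x)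
    outside-j w (pw≡j , cw≡x) = j≢i (trans (sym pw≡j) (proj₂ pure w cw≡x))

  cellCount≥1 : ∀ {i w} → part w ≡ i → 1 ≤ cellCount i (c w)
  cellCount≥1 {i} {w} pw≡i = count-≥1 (λ v → part v ≟ i ×-dec c v ≟ c w) (pw≡i , refl)

  cellCount≥2 : ∀ {i w w′} → w ≢ w′ → part w ≡ i → part w′ ≡ i → c w ≡ c w′ →
                2 ≤ cellCount i (c w)
  cellCount≥2 {i} {w} w≢w′ pw≡i pw′≡i cw≡cw′ =
    count-≥2 (λ v → part v ≟ i ×-dec c v ≟ c w) w≢w′ (pw≡i , refl) (pw′≡i , sym cw≡cw′)

  ∑-cellCount-row : ∀ i → ∑[ x < p ] cellCount i x ≡ ∣ PartSet part i ∣
  ∑-cellCount-row i =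
    trans (∑-count-fibres (λ w → part w ≟ i) c) (sym (∣tabulate∣≡count (λ w → part w ≟ i)))

  ∑-cellCount-column : ∀ x → ∑[ i < k ] cellCount i x ≡ count (λ w → c w ≟ x)
  ∑-cellCount-column x = trans (sum-cong-≗ λ i → count-cong (λ w → part w ≟ i ×-dec c w ≟ x)
                                                             (λ w → c w ≟ x ×-dec part w ≟ i)
                                                             (λ _ → swap) (λ _ → swap))
                               (∑-count-fibres (λ w → c w ≟ x) part)

  row-charge≥ : ∀ {m} i → m ≤ ∣ PartSet part i ∣ →
                (∀ x → Pure i x → m ≤ ∑[ y < p ] charge i y) → m ≤ ∑[ y < p ] charge i y
  row-charge≥ {m} i m≤size pure-case with any? (pure? i)
  ... | yes (x , pure) = pure-case x pure
  ... | no none = subst (m ≤_) (sym ∑charge≡size) m≤size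
    where
    ∑charge≡size : ∑[ y < p ] charge i y ≡ ∣ PartSet part i ∣
    ∑charge≡size =
      trans (sum-cong-≗ λ y → charge-impure λ pure → none (y , pure)) (∑-cellCount-row i)

  row-charge≥d : ∀ i → d ≤ ∣ PartSet part i ∣ → d ≤ ∑[ y < p ] charge i y
  row-charge≥d i d≤size = row-charge≥ i d≤size λ x pure →
    subst (_≤ ∑[ y < p ] charge i y) (charge-pure pure) (term≤sum (charge i) x)

  row-charge≥1+d : 1 ≤ d → ∀ i → suc d ≤ ∣ PartSet part i ∣ →
                   (∀ x → ∃[ w ] (part w ≡ i × c w ≢ x)) → suc d ≤ ∑[ y < p ] charge i y
  row-charge≥1+d 1≤d i size≥ missed = row-charge≥ i size≥ λ x pure →
    let (w , pw≡i , cw≢x) = missed x in begin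
      suc d                        ≡⟨ +-comm 1 d ⟩
      d + 1                        ≡⟨ cong (_+ 1) (charge-pure pure) ⟨
      charge i x + 1               ≤⟨ +-monoʳ-≤ (charge i x) (charge≥ 1≤d (cellCount≥1 pw≡i)) ⟩
      charge i x + charge i (c w)  ≤⟨ pair≤sum (charge i) (cw≢x ∘ sym) ⟩
      ∑[ y < p ] charge i y        ∎
    where open ≤-Reasoning

  MissedTwice : Fin k → Fin p → Set
  MissedTwice i x = ∃[ w ] ∃[ w′ ] (w ≢ w′ × part w ≡ i × part w′ ≡ i × c w ≢ x × c w′ ≢ x)

  row-charge≥2+d : 2 ≤ d → ∀ i → suc (suc d) ≤ ∣ PartSet part i ∣ → (∀ x → MissedTwice i x) →
                   suc (suc d) ≤ ∑[ y < p ] charge i y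
  row-charge≥2+d 2≤d i size≥ missed = row-charge≥ i size≥ λ x pure → pure-case pure (missed x)
    where
    open ≤-Reasoning
    1≤d : 1 ≤ d
    1≤d = ≤-trans (n≤1+n 1) 2≤d
    pure-case : ∀ {x} → Pure i x → MissedTwice i x → suc (suc d) ≤ ∑[ y < p ] charge i y
    pure-case {x} pure (w , w′ , w≢w′ , pw≡i , pw′≡i , cw≢x , cw′≢x) with c w ≟ c w′
    ... | yes cw≡cw′ = begin
      suc (suc d)                  ≡⟨ +-comm 2 d ⟩
      d + 2                        ≡⟨ cong (_+ 2) (charge-pure pure) ⟨
      charge i x + 2               ≤⟨ +-monoʳ-≤ (charge i x)
                                        (charge≥ 2≤d (cellCount≥2 w≢w′ pw≡i pw′≡i cw≡cw′)) ⟩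
      charge i x + charge i (c w)  ≤⟨ pair≤sum (charge i) (cw≢x ∘ sym) ⟩
      ∑[ y < p ] charge i y        ∎
    ... | no cw≢cw′ = begin
      suc (suc d)                                    ≡⟨ +-comm 2 d ⟩
      d + 2                                          ≡⟨ cong (_+ 2) (charge-pure pure) ⟨
      charge i x + 2                                 ≡⟨ +-assoc (charge i x) 1 1 ⟨
      charge i x + 1 + 1                             ≤⟨ +-mono-≤
        (+-monoʳ-≤ (charge i x) (charge≥ 1≤d (cellCount≥1 pw≡i))) (charge≥ 1≤d (cellCount≥1 pw′≡i)) ⟩
      charge i x + charge i (c w) + charge i (c w′)  ≤⟨ triple≤sum (charge i)
                                                          (cw≢x ∘ sym) (cw′≢x ∘ sym) cw≢cw′ ⟩
      ∑[ y < p ] charge i y                          ∎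

  module _ .{{_ : NonZero d}} (proper : Proper (CompleteMultipartite (suc d) part) c) where

    impure-colourClass≤ : ∀ x → (∀ i → ¬ Pure i x) → count (λ w → c w ≟ x) ≤ d
    impure-colourClass≤ x impure with any? (λ w → c w ≟ x)
    ... | no absent =
      subst (_≤ d) (sym (count-empty (λ w → c w ≟ x) λ w cw≡x → absent (w , cw≡x))) z≤n
    ... | yes (u , cu≡x) with any? (λ v → c v ≟ x ×-dec ¬? (part v ≟ part u))
    ...   | yes (v , cv≡x , pv≢pu) = spanning-colourClass≤ d part proper cu≡x cv≡x (pv≢pu ∘ sym)
    ...   | no confined = contradiction ((u , cu≡x) , within) (impure (part u))
      where
      within : ∀ w → c w ≡ x → part w ≡ part u
      within w cw≡x = decidable-stable (part w ≟ part u) λ pw≢pu → confined (w , cw≡x , pw≢pu)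

    column-charge≤d : ∀ x → ∑[ i < k ] charge i x ≤ d
    column-charge≤d x with any? (λ i → pure? i x)
    ... | yes (i , pure) = ≤-reflexive (begin
      ∑[ j < k ] charge j x  ≡⟨ sum-supported (λ j → charge j x) i (λ _ → charge-elsewhere pure) ⟩
      charge i x             ≡⟨ charge-pure pure ⟩
      d                      ∎)
      where open ≡-Reasoning
    ... | no none = begin
      ∑[ i < k ] charge i x     ≡⟨ sum-cong-≗ (λ i → charge-impure λ pure → none (i , pure)) ⟩
      ∑[ i < k ] cellCount i x  ≡⟨ ∑-cellCount-column x ⟩
      count (λ w → c w ≟ x)     ≤⟨ impure-colourClass≤ x (λ i pure → none (i , pure)) ⟩
      d                         ∎
      where open ≤-Reasoning

    total-charge≤ : (L : Fin k → ℕ) → (∀ i → L i ≤ ∑[ x < p ] charge i x) →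
                    ∑[ i < k ] L i ≤ p * d
    total-charge≤ L L≤row = begin
      ∑[ i < k ] L i                    ≤⟨ sum-mono L≤row ⟩
      ∑[ i < k ] ∑[ x < p ] charge i x  ≡⟨ ∑-comm charge ⟩
      ∑[ x < p ] ∑[ i < k ] charge i x  ≤⟨ sum-mono column-charge≤d ⟩
      ∑[ x < p ] d                      ≡⟨ sum-const p d ⟩
      p * d                             ∎
      where open ≤-Reasoning

colourable⇒parts≤colours : ∀ {n k m} d .{{_ : NonZero d}} (part : Fin n → Fin k) →
                           (∀ i → d ≤ ∣ PartSet part i ∣) →
                           Colorable (CompleteMultipartite (suc d) part) m → k ≤ m
colourable⇒parts≤colours {k = k} {m} d part d≤size (c , proper) = *-cancelʳ-≤ k m d (begin
  k * d         ≡⟨ sum-const k d ⟨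
  ∑[ i < k ] d  ≤⟨ total-charge≤ proper (λ _ → d) (λ i → row-charge≥d i (d≤size i)) ⟩
  m * d         ∎)
  where
  open Charging d part c
  open ≤-Reasoning

module _ (t : ℕ) where

  skipBlock : ℕ → ℕ → ℕ
  skipBlock b j with j <? b * t
  ... | yes _ = j
  ... | no _ = j + t

  skipBlock-injective : ∀ b → Injective _≡_ _≡_ (skipBlock b)
  skipBlock-injective b {j} {j′} eq with j <? b * t | j′ <? b * t
  ... | yes _ | yes _ = eq
  ... | no _ | no _ = +-cancelʳ-≡ t j j′ eq
  ... | yes j<bt | no j′≮bt =
    contradiction (≤-<-trans (m≤m+n j′ t) (subst (_< b * t) eq j<bt)) j′≮bt
  ... | no j≮bt | yes j′<bt =
    contradiction (≤-<-trans (m≤m+n j t) (subst (_< b * t) (sym eq) j′<bt)) j≮bt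

  skipBlock-< : ∀ b {j m} → j < m → skipBlock b j < m + t
  skipBlock-< b {j} {m} j<m with j <? b * t
  ... | yes _ = ≤-trans j<m (m≤m+n m t)
  ... | no _ = +-monoˡ-< t j<m

  skipBlock-skips : .{{_ : NonZero t}} → ∀ {x b} j → x / t ≡ b → skipBlock b j ≢ x
  skipBlock-skips {x} {b} j x/t≡b with j <? b * t
  ... | yes j<bt = <⇒≢ (<-≤-trans j<bt (subst (λ b → b * t ≤ x) x/t≡b (m/n*n≤m x t)))
  ... | no j≮bt = >⇒≢ (<-≤-trans (subst (λ b → x < b * t + t) x/t≡b x<[x/t]*t+t)
                                 (+-monoˡ-≤ t (≮⇒≥ j≮bt)))
    where
    x<[x/t]*t+t : x < x / t * t + t
    x<[x/t]*t+t = begin-strict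
      x                  ≡⟨ m≡m%n+[m/n]*n x t ⟩
      x % t + x / t * t  <⟨ +-monoˡ-< (x / t * t) (m%n<n x t) ⟩
      t + x / t * t      ≡⟨ +-comm t (x / t * t) ⟩
      x / t * t + t      ∎
      where open ≤-Reasoning

blockLists : ∀ {n k} (t : ℕ) → (Fin n → ℕ) → ListAssignment n k
blockLists t block = (λ w j → skipBlock t (block w) (toℕ j)) ,
                     (λ w → toℕ-injective ∘ skipBlock-injective t (block w))

module _ {n k : ℕ} (part : Fin n → Fin k) where

  rankInPart : Fin n → ℕ
  rankInPart w = rank (λ u → part u ≟ part w) w

  vertex-of-rank : ∀ i {j} → j < ∣ PartSet part i ∣ → ∃[ w ] (part w ≡ i × rankInPart w ≡ j)
  vertex-of-rank i {j} j<size
    with rank-surjective (λ u → part u ≟ i)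
                         (subst (j <_) (∣tabulate∣≡count (λ u → part u ≟ i)) j<size)
  ... | w , pw≡i , rank≡j = w , pw≡i , trans (cong (λ i → rank (λ u → part u ≟ i) w) pw≡i) rank≡j

r≤sizes : ∀ r {k} (i : Fin k) → r ≤ sizes r i
r≤sizes r i with toℕ i
... | zero = m≤m+n r (r + 0)
... | suc _ = ≤-refl

sizes-zero : ∀ r {k} → sizes r {suc k} zero ≡ r + r
sizes-zero r = cong (r +_) (+-identityʳ r)

module BlockLists {n k′ : ℕ} (s t : ℕ) .{{_ : NonZero t}} (k≡t*d : suc k′ ≡ t * suc (suc s))
                  (part : Fin n → Fin (suc k′)) (sized : HasPartSizes part (sizes (3 + s))) where

  d r k p : ℕ
  d = suc (suc s)
  r = suc d
  k = suc k′
  p = k + t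

  position : Fin n → ℕ
  position w = rankInPart part w % r

  block : Fin p → ℕ
  block x = toℕ x / t

  block<r : ∀ x → block x < r
  block<r x = m<n*o⇒m/o<n (subst (toℕ x <_) p≡r*t (toℕ<n x))
    where
    open ≡-Reasoning
    p≡r*t : p ≡ r * t
    p≡r*t = begin
      k + t      ≡⟨ cong (_+ t) k≡t*d ⟩
      t * d + t  ≡⟨ +-comm (t * d) t ⟩
      t + t * d  ≡⟨ *-suc t d ⟨
      t * r      ≡⟨ *-comm t r ⟩
      r * t      ∎

  block%r : ∀ x → block x % r ≡ block x
  block%r x = m<n⇒m%n≡m (block<r x)

  p*d≡k*r : p * d ≡ k * r
  p*d≡k*r = begin
    (k + t) * d    ≡⟨ *-distribʳ-+ d k t ⟩
    k * d + t * d  ≡⟨ cong (k * d +_) k≡t*d ⟨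
    k * d + k      ≡⟨ +-comm (k * d) k ⟩
    k + k * d      ≡⟨ *-suc k d ⟨
    k * r          ∎
    where open ≡-Reasoning

  size₀ : ∣ PartSet part zero ∣ ≡ r + r
  size₀ = trans (sized zero) (sizes-zero r {k′})

  module _ {c : Fin n → ℕ} (c∈lists : ∀ v → Σ[ j ∈ Fin k ] c v ≡ skipBlock t (position v) (toℕ j))
    where

    c<p : ∀ v → c v < p
    c<p v = let (j , cv≡) = c∈lists v in
      subst (_< p) (sym cv≡) (skipBlock-< t (position v) (toℕ<n j))

    c′ : Fin n → Fin p
    c′ v = fromℕ< (c<p v)

    c′-skips : ∀ w x → position w ≡ block x → c′ w ≢ x
    c′-skips w x pos≡block c′w≡x = skipBlock-skips t (toℕ j) (sym pos≡block)
      (trans (sym cw≡) (trans (sym (toℕ-fromℕ< (c<p w))) (cong toℕ c′w≡x)))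
      where
      j = proj₁ (c∈lists w)
      cw≡ = proj₂ (c∈lists w)

    open Charging d part c′ using (MissedTwice)

    missed-once : ∀ i x → ∃[ w ] (part w ≡ i × c′ w ≢ x)
    missed-once i x
      with vertex-of-rank part i (<-≤-trans (block<r x) (subst (r ≤_) (sym (sized i)) (r≤sizes r i)))
    ... | w , pw≡i , rank≡b = w , pw≡i , c′-skips w x (trans (cong (_% r) rank≡b) (block%r x))

    missed-twice : ∀ x → MissedTwice zero x
    missed-twice x
      with vertex-of-rank part zero (subst (block x <_) (sym size₀) (<-≤-trans (block<r x) (m≤m+n r r)))
         | vertex-of-rank part zero (subst (block x + r <_) (sym size₀) (+-monoˡ-< r (block<r x)))
    ... | w , pw≡0 , rank≡b | w′ , pw′≡0 , rank′≡b+r =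
      w , w′ , w≢w′ , pw≡0 , pw′≡0 ,
      c′-skips w x (trans (cong (_% r) rank≡b) (block%r x)) ,
      c′-skips w′ x (trans (cong (_% r) rank′≡b+r) (trans ([m+n]%n≡m%n (block x) r) (block%r x)))
      where
      w≢w′ : w ≢ w′
      w≢w′ w≡w′ = m+1+n≢m (block x)
        (trans (sym rank′≡b+r) (trans (cong (rankInPart part) (sym w≡w′)) rank≡b))

  not-choosable : ¬ Choosable (CompleteMultipartite r part) k
  not-choosable choose with choose (blockLists t position)
  ... | c , c∈lists , proper = <-irrefl refl (begin-strict
    k * r               ≡⟨ cong (r +_) (sum-const k′ r) ⟨
    r + ∑[ i < k′ ] r   <⟨ n<1+n _ ⟩
    ∑[ i < k ] bound i  ≤⟨ total-charge≤ proper′ bound row-bound ⟩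
    p * d               ≡⟨ p*d≡k*r ⟩
    k * r               ∎)
    where
    open ≤-Reasoning
    open Charging d part (c′ c∈lists)
    proper′ : Proper (CompleteMultipartite r part) (c′ c∈lists)
    proper′ = proper-reflect toℕ (λ v → toℕ-fromℕ< (c<p c∈lists v)) proper
    bound : Fin k → ℕ
    bound zero = suc r
    bound (suc _) = r
    row-bound : ∀ i → bound i ≤ ∑[ x < p ] charge i x
    row-bound zero = row-charge≥2+d (s≤s (s≤s z≤n)) zero
      (subst (suc r ≤_) (sym size₀) (subst (_≤ r + r) (+-comm r 1) (+-monoʳ-≤ r (s≤s z≤n))))
      (missed-twice c∈lists)
    row-bound (suc i) = row-charge≥1+d (s≤s z≤n) (suc i)
      (subst (r ≤_) (sym (sized (suc i))) ≤-refl) (missed-once c∈lists (suc i))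

theorem3p1 : (r k : ℕ) → 3 ≤ r → 1 ≤ k → (r ∸ 1) ∣ k →
    (n : ℕ) (part : Fin n → Fin k) → HasPartSizes part (sizes r) →
    ChoiceNumberGreaterThan (CompleteMultipartite r part) k
      × ChromaticNumberIs (CompleteMultipartite r part) k
theorem3p1 r@(suc (suc (suc s))) k@(suc k′) (s≤s (s≤s (s≤s _))) (s≤s _) (divides (suc t′) k≡t*d)
           n part sized =
  not-choosable , (part , part-proper r part) , fewer-colours
  where
  fewer-colours : ∀ m → m < k → ¬ Colorable (CompleteMultipartite r part) m
  fewer-colours m m<k colouring = <⇒≱ m<k (colourable⇒parts≤colours (suc (suc s)) part
    (λ i → subst (suc (suc s) ≤_) (sym (sized i)) (≤-trans (n≤1+n _) (r≤sizes r i))) colouring)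
  not-choosable : ChoiceNumberGreaterThan (CompleteMultipartite r part) k
  not-choosable m m≤k with m≤n⇒m<n∨m≡n m≤k
  ... | inj₁ m<k = fewer-colours m m<k ∘ choosable⇒colourable
  ... | inj₂ refl = BlockLists.not-choosable s (suc t′) k≡t*d part sized
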